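{- Let $G$ be a connected undirected simple graph, let $f_0$ be an initial valuation, and let $f_0,f_1,f_2,\dots$ be updated according to the asynchronous maximum model. Let $g(f_t)=|S_t|$, where $S_t$ is the strong edge set of $f_t$. Then (for every realization of the process) the sequence $g(f_t)$ is non-negative, non-decreasing in $t$, and bounded above by $n$.
   Context: Let $G=(V,E)$ be a finite simple undirected graph with $n=|V|$ vertices and $[n]=\{1,\dots,n\}$. A valuation is a function $f:V\to[n]$. The asynchronous maximum model: given the current valuation $f_t$, choose $v'\in V$ uniformly at random; set $f_{t+1}(v')=\max\{f_t(u): u\neq v' \text{ adjacent to } v'\}$ (unchanged if $v'$ has no neighbour), and $f_{t+1}(v)=f_t(v)$ for $v\neq v'$. Let $M_t=\max_{v\in V} f_t(v)$. An edge $uv\in E$ is a strong edge (for $f_t$) if $f_t(u)=f_t(v)=M_t$. The strong edge set $S_t\subseteq V$ is the set of all vertices belonging to at least one strong edge (possibly empty). -}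

module Defs where

open import Data.Nat using (ℕ; zero; suc; _⊔_; _≤_; _≡ᵇ_)
open import Data.Fin using (Fin; _≟_)
open import Data.Bool using (Bool; true; false; _∧_; if_then_else_)
open import Data.List using (List; []; _∷_; allFin; filterᵇ; foldr; map; length)
open import Data.Bool.ListAction using (any)
open import Data.Product using (_×_)
open import Relation.Nullary using (does)
open import Relation.Binary.PropositionalEquality using (_≡_)

record SimpleGraph (n : ℕ) : Set where
  field
    adj    : Fin n → Fin n → Bool
    sym    : ∀ u v → adj u v ≡ adj v u
    irrefl : ∀ v → adj v v ≡ false
open SimpleGraph public

data Reach {n : ℕ} (G : SimpleGraph n) : Fin n → Fin n → Set where
  here : ∀ {v} → Reach G v v
  step : ∀ {u v w} → adj G u v ≡ true → Reach G v w → Reach G u w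

Connected : ∀ {n} → SimpleGraph n → Set
Connected {n} G = ∀ (u v : Fin n) → Reach G u v

Valuation : ℕ → Set
Valuation n = Fin n → ℕ

InRange : ∀ {n} → Valuation n → Set
InRange {n} f = ∀ v → (1 ≤ f v) × (f v ≤ n)

maxList : List ℕ → ℕ
maxList = foldr _⊔_ 0

nbrs : ∀ {n} → SimpleGraph n → Fin n → List (Fin n)
nbrs {n} G v = filterᵇ (adj G v) (allFin n)

newValue : ∀ {n} → SimpleGraph n → Valuation n → Fin n → ℕ
newValue G f v with nbrs G v
... | []     = f v
... | u ∷ us = maxList (map f (u ∷ us))

update : ∀ {n} → SimpleGraph n → Valuation n → Fin n → Valuation n
update G f v' v = if does (v ≟ v') then newValue G f v' else f v

-- realization of the process for a sequence of chosen vertices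
trajectory : ∀ {n} → SimpleGraph n → Valuation n → (ℕ → Fin n) → ℕ → Valuation n
trajectory G f₀ choice zero    = f₀
trajectory G f₀ choice (suc t) = update G (trajectory G f₀ choice t) (choice t)

maxVal : ∀ {n} → Valuation n → ℕ
maxVal {n} f = maxList (map f (allFin n))

-- v is in the strong edge set: v lies on an edge uv with f u = f v = M
inStrong : ∀ {n} → SimpleGraph n → Valuation n → Fin n → Bool
inStrong {n} G f v =
  (f v ≡ᵇ maxVal f) ∧ any (λ u → adj G v u ∧ (f u ≡ᵇ maxVal f)) (allFin n)

strongSet : ∀ {n} → SimpleGraph n → Valuation n → List (Fin n)
strongSet {n} G f = filterᵇ (inStrong G f) (allFin n)

g : ∀ {n} → SimpleGraph n → Valuation n → ℕ
g G f = length (strongSet G f)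

-- An update never raises the maximum M, and a vertex with a neighbour at value M
-- is updated to M. So both endpoints of a strong edge keep the value M, which
-- therefore stays the maximum, and the edge stays strong: S_t only grows.
module Submission where

open import Defs hiding (sym)
open import Data.Nat using (ℕ; suc; z≤n; _≤_; _≤′_; ≤′-reflexive; ≤′-step; _≡ᵇ_; _⊔_)
open import Data.Nat.Properties
  using (≤-refl; ≤-trans; ≤-antisym; ≤-reflexive; ⊔-lub; m⊔n≤o⇒m≤o; m⊔n≤o⇒n≤o; ≡ᵇ⇒≡; ≡⇒≡ᵇ; ≤⇒≤′)
open import Data.Fin using (Fin; _≟_)
open import Data.Bool using (Bool; T; T?; _∧_)
open import Data.Bool.Properties using (T-∧)
open import Data.List using (_∷_; []; allFin; map)
open import Data.List.Properties using (foldr-preservesᵇ; foldr-forcesᵇ; length-filter; length-tabulate)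
open import Data.List.Membership.Propositional using (_∈_; lose)
open import Data.List.Membership.Propositional.Properties using (∈-map⁺; ∈-filter⁺; ∈-allFin)
open import Data.List.Relation.Unary.All as All using ()
open import Data.List.Relation.Unary.All.Properties using () renaming (map⁺ to All-map⁺)
open import Data.List.Relation.Unary.Any using (satisfied)
open import Data.List.Relation.Unary.Any.Properties using (any⁺; any⁻)
open import Data.List.Relation.Binary.Sublist.Propositional using (⊆-refl)
open import Data.List.Relation.Binary.Sublist.Propositional.Properties using (filter⁺; length-mono-≤)
open import Data.Product using (_×_; _,_; ∃-syntax)
open import Function using (_∘_; id; Equivalence)
open import Relation.Nullary using (yes; no)
open import Relation.Binary.PropositionalEquality using (_≡_; refl; sym; trans; subst)

open Equivalence using (to; from)

maxList-lub : ∀ {A : Set} (f : A → ℕ) {b} → (∀ x → f x ≤ b) → ∀ xs → maxList (map f xs) ≤ b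
maxList-lub f {b} f≤b xs = foldr-preservesᵇ {P = _≤ b} ⊔-lub z≤n (All-map⁺ (All.universal f≤b xs))

∈⇒≤maxList : ∀ {x xs} → x ∈ xs → x ≤ maxList xs
∈⇒≤maxList {xs = xs} = All.lookup (foldr-forcesᵇ ⊔≤⇒both≤ 0 xs ≤-refl)
  where
  ⊔≤⇒both≤ : ∀ x y → x ⊔ y ≤ maxList xs → x ≤ maxList xs × y ≤ maxList xs
  ⊔≤⇒both≤ x y x⊔y≤max = m⊔n≤o⇒m≤o x y x⊔y≤max , m⊔n≤o⇒n≤o x y x⊔y≤max

≤-stepwise⇒≤ : (a : ℕ → ℕ) → (∀ t → a t ≤ a (suc t)) → ∀ {s t} → s ≤ t → a s ≤ a t
≤-stepwise⇒≤ a a≤a∘suc s≤t = go (≤⇒≤′ s≤t)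
  where
  go : ∀ {s t} → s ≤′ t → a s ≤ a t
  go (≤′-reflexive refl) = ≤-refl
  go (≤′-step s≤′t)      = ≤-trans (go s≤′t) (a≤a∘suc _)

module _ {n : ℕ} (f : Valuation n) where

  ≤maxVal : ∀ v → f v ≤ maxVal f
  ≤maxVal v = ∈⇒≤maxList (∈-map⁺ f (∈-allFin v))

  bound-attained⇒maxVal≡ : ∀ {b} → (∀ v → f v ≤ b) → ∀ v → f v ≡ b → maxVal f ≡ b
  bound-attained⇒maxVal≡ f≤b v fv≡b =
    ≤-antisym (maxList-lub f f≤b (allFin n)) (subst (_≤ maxVal f) fv≡b (≤maxVal v))

module _ {n : ℕ} (G : SimpleGraph n) where

  IsStrong : Valuation n → Fin n → Set
  IsStrong f v = f v ≡ maxVal f × ∃[ u ] (T (adj G v u) × f u ≡ maxVal f)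

  private
    adjAtMax : Valuation n → Fin n → Fin n → Bool
    adjAtMax f v u = adj G v u ∧ (f u ≡ᵇ maxVal f)

  inStrong⇒IsStrong : ∀ {f v} → T (inStrong G f v) → IsStrong f v
  inStrong⇒IsStrong {f} {v} v∈S =
    let fv≡M , someAdjAtMax = to T-∧ v∈S
        u , uAdjAtMax       = satisfied (any⁻ (adjAtMax f v) (allFin n) someAdjAtMax)
        vu , fu≡M           = to T-∧ uAdjAtMax
    in ≡ᵇ⇒≡ _ _ fv≡M , u , vu , ≡ᵇ⇒≡ _ _ fu≡M

  IsStrong⇒inStrong : ∀ {f v} → IsStrong f v → T (inStrong G f v)
  IsStrong⇒inStrong {f} {v} (fv≡M , u , vu , fu≡M) = from T-∧
    ( ≡⇒≡ᵇ _ _ fv≡M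
    , any⁺ (adjAtMax f v) (lose (∈-allFin u) (from T-∧ (vu , ≡⇒≡ᵇ _ _ fu≡M))))

  adj⇒∈nbrs : ∀ {w u} → T (adj G w u) → u ∈ nbrs G w
  adj⇒∈nbrs {w} {u} = ∈-filter⁺ (T? ∘ adj G w) (∈-allFin u)

  module _ (f : Valuation n) where

    newValue≤maxVal : ∀ w → newValue G f w ≤ maxVal f
    newValue≤maxVal w with nbrs G w
    ... | []     = ≤maxVal f w
    ... | u ∷ us = maxList-lub f (≤maxVal f) (u ∷ us)

    adj⇒≤newValue : ∀ {w u} → T (adj G w u) → f u ≤ newValue G f w
    adj⇒≤newValue {w} wu with nbrs G w | adj⇒∈nbrs wu
    ... | u ∷ us | u∈nbrs = ∈⇒≤maxList (∈-map⁺ f u∈nbrs)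

    adjAtMax⇒newValue≡maxVal : ∀ {w u} → T (adj G w u) → f u ≡ maxVal f → newValue G f w ≡ maxVal f
    adjAtMax⇒newValue≡maxVal {w} wu fu≡M =
      ≤-antisym (newValue≤maxVal w) (subst (_≤ newValue G f w) fu≡M (adj⇒≤newValue wu))

    update≤maxVal : ∀ w v → update G f w v ≤ maxVal f
    update≤maxVal w v with v ≟ w
    ... | yes refl = newValue≤maxVal v
    ... | no _     = ≤maxVal f v

    update-fixes-adjAtMax : ∀ w {v u} → T (adj G v u) → f v ≡ maxVal f → f u ≡ maxVal f →
                            update G f w v ≡ f v
    update-fixes-adjAtMax w {v} vu fv≡M fu≡M with v ≟ w
    ... | yes refl = trans (adjAtMax⇒newValue≡maxVal vu fu≡M) (sym fv≡M)
    ... | no _     = refl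

    IsStrong-update : ∀ w {v} → IsStrong f v → IsStrong (update G f w) v
    IsStrong-update w {v} (fv≡M , u , vu , fu≡M) = trans f′v≡M (sym M′≡M) , u , vu , trans f′u≡M (sym M′≡M)
      where
      f′ : Valuation n
      f′ = update G f w
      f′v≡M : f′ v ≡ maxVal f
      f′v≡M = trans (update-fixes-adjAtMax w vu fv≡M fu≡M) fv≡M
      f′u≡M : f′ u ≡ maxVal f
      f′u≡M = trans (update-fixes-adjAtMax w (subst T (SimpleGraph.sym G v u) vu) fu≡M fv≡M) fu≡M
      M′≡M : maxVal f′ ≡ maxVal f
      M′≡M = bound-attained⇒maxVal≡ f′ (update≤maxVal w) v f′v≡M

    g-update : ∀ w → g G f ≤ g G (update G f w)
    g-update w = length-mono-≤ (filter⁺ (T? ∘ inStrong G f) (T? ∘ inStrong G (update G f w))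
                                  (λ { refl → IsStrong⇒inStrong ∘ IsStrong-update w ∘ inStrong⇒IsStrong })
                                  (⊆-refl {x = allFin n}))

    g≤n : g G f ≤ n
    g≤n = ≤-trans (length-filter (T? ∘ inStrong G f) (allFin n)) (≤-reflexive (length-tabulate id))

mainTheorem7 : ∀ (n : ℕ) (G : SimpleGraph n) → Connected G → (f₀ : Valuation n) → InRange f₀ → (choice : ℕ → Fin n) → ((t : ℕ) → 0 ≤ g G (trajectory G f₀ choice t)) × ((s t : ℕ) → s ≤ t → g G (trajectory G f₀ choice s) ≤ g G (trajectory G f₀ choice t)) × ((t : ℕ) → g G (trajectory G f₀ choice t) ≤ n)
mainTheorem7 n G _ f₀ _ choice =
    (λ _ → z≤n)
  , (λ _ _ → ≤-stepwise⇒≤ (g G ∘ fₜ) (λ t → g-update G (fₜ t) (choice t)))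
  , (λ t → g≤n G (fₜ t))
  where
  fₜ : ℕ → Valuation n
  fₜ = trajectory G f₀ choice
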